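{- Let $k\geq 1$, $n\geq 2k+1$ and $r\geq 2$ be integers. Every rank two residue of $\Gamma(KG(n,k),r)$ is isomorphic to the neighborhood geometry $\tilde{KG}(n,k)$ of the Kneser graph $KG(n,k)$.
   Context: Let $\Omega=\{1,\ldots,n+k(r-2)\}$, $I=\{1,\ldots,r\}$. The incidence system $\Gamma(KG(n,k),r)=(X,*,t,I)$ has element set $X=X_1\cup\cdots\cup X_r$, a disjoint union of $r$ copies of the set of all $k$-subsets of $\Omega$; $t(x)=i$ for $x\in X_i$; $x\in X_i$ and $y\in X_j$ are incident iff $x=y$ or ($i\neq j$ and $x\cap y=\emptyset$). A flag is a set of pairwise incident elements. The residue of a flag $F$ consists of the elements incident to all elements of $F$ and not in $F$, with type set $I\setminus t(F)$ and restricted incidence; it has rank two when $F$ has $r-2$ elements. The Kneser graph $KG(n,k)$ has vertices the $k$-subsets of $\{1,\ldots,n\}$, adjacent iff disjoint. For a graph $G$ with vertex set $G_0$, its neighborhood geometry $\tilde G$ has elements $G_0\times\{0\}\cup G_0\times\{1\}$ (type $i$ on $G_0\times\{i\}$), with $(p,0)$ incident to $(q,1)$ iff $p,q$ are adjacent in $G$. Isomorphism of rank two geometries means a bijection of elements preserving incidence and mapping elements of the same type to elements of the same type. -}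

module Defs where

open import Data.Nat using (ℕ; _+_; _*_; _∸_; _≡ᵇ_)
open import Data.Bool using (Bool; true; false; T; not; _∧_; _∨_)
import Data.Bool as Bool
open import Data.Unit using (tt)
open import Data.Fin using (Fin)
import Data.Fin as Fin
open import Data.Fin.Subset using (Subset; ∣_∣; _∩_)
open import Data.Product using (Σ; _×_; _,_; proj₁; proj₂)
import Data.Product.Properties as ×P
import Data.Vec.Properties as VecP
open import Data.List using (List; length)
open import Data.Bool.ListAction using (all; any)
open import Data.List.Relation.Unary.Unique.Propositional using (Unique)
open import Data.List.Relation.Unary.AllPairs using (AllPairs)
open import Relation.Nullary using (yes; no)
open import Relation.Nullary.Decidable using (⌊_⌋)
open import Relation.Binary.Definitions using (DecidableEquality)
open import Relation.Binary.PropositionalEquality using (_≡_; refl)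
open import Function.Definitions using (Bijective)

record IncSys : Set₁ where
  field
    Elt  : Set
    Typ  : Set
    typ  : Elt → Typ
    inc  : Elt → Elt → Bool
    _≟ₑ_ : DecidableEquality Elt

open IncSys public

record IsFlag (G : IncSys) (F : List (Elt G)) : Set where
  field
    unique   : Unique F
    pairwise : AllPairs (λ x y → T (inc G x y)) F

memb : (G : IncSys) → Elt G → List (Elt G) → Bool
memb G x F = any (λ f → ⌊ _≟ₑ_ G x f ⌋) F

Residue : (G : IncSys) → List (Elt G) → IncSys
Residue G F = record
  { Elt  = Σ (Elt G) (λ x → T (all (λ f → inc G x f) F ∧ not (memb G x F)))
  ; Typ  = Typ G
  ; typ  = λ x → typ G (proj₁ x)
  ; inc  = λ x y → inc G (proj₁ x) (proj₁ y)
  ; _≟ₑ_ = ×P.≡-dec (_≟ₑ_ G) T-dec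
  }
  where
  T-dec : ∀ {b} → DecidableEquality (T b)
  T-dec {true} tt tt = yes refl

Isomorphic : IncSys → IncSys → Set
Isomorphic G H =
  Σ (Elt G → Elt H) λ φ →
    Bijective _≡_ _≡_ φ
    × (∀ x y → inc G x y ≡ inc H (φ x) (φ y))
    × (∀ x y → typ G x ≡ typ G y → typ H (φ x) ≡ typ H (φ y))

KSub : ℕ → ℕ → Set
KSub m k = Σ (Subset m) (λ s → T (∣ s ∣ ≡ᵇ k))

KSub-dec : ∀ {m k} → DecidableEquality (KSub m k)
KSub-dec = ×P.≡-dec (VecP.≡-dec Bool._≟_) T-dec
  where
  T-dec : ∀ {b} → DecidableEquality (T b)
  T-dec {true} tt tt = yes refl

disjoint : ∀ {m} → Subset m → Subset m → Bool
disjoint p q = ∣ p ∩ q ∣ ≡ᵇ 0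

-- Γ(KG(n,k), r): r copies of the k-subsets of Ω = {1,…,n+k(r-2)}

Γ : (n k r : ℕ) → IncSys
Γ n k r = record
  { Elt  = Fin r × KSub (n + k * (r ∸ 2)) k
  ; Typ  = Fin r
  ; typ  = proj₁
  ; inc  = λ { (i , x) (j , y) →
              ⌊ ×P.≡-dec Fin._≟_ KSub-dec (i , x) (j , y) ⌋
              ∨ (not ⌊ i Fin.≟ j ⌋ ∧ disjoint (proj₁ x) (proj₁ y)) }
  ; _≟ₑ_ = ×P.≡-dec Fin._≟_ KSub-dec
  }

record Graph : Set₁ where
  field
    V    : Set
    adj  : V → V → Bool
    _≟ᵥ_ : DecidableEquality V

KG : ℕ → ℕ → Graph
KG n k = record
  { V    = KSub n k
  ; adj  = λ x y → disjoint (proj₁ x) (proj₁ y)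
  ; _≟ᵥ_ = KSub-dec
  }

-- neighbourhood geometry: elements G₀ × {0,1} (type = second coordinate);
-- (p,0) * (q,1) iff p ~ q (incidence taken symmetric and reflexive,
-- as in any incidence system)
Nbhd : Graph → IncSys
Nbhd G = record
  { Elt  = Graph.V G × Fin 2
  ; Typ  = Fin 2
  ; typ  = proj₂
  ; inc  = λ { (p , a) (q , b) →
              ⌊ ×P.≡-dec (Graph._≟ᵥ_ G) Fin._≟_ (p , a) (q , b) ⌋
              ∨ (not ⌊ a Fin.≟ b ⌋ ∧ Graph.adj G p q) }
  ; _≟ₑ_ = ×P.≡-dec (Graph._≟ᵥ_ G) Fin._≟_
  }

-- An element of a flag F of size r − 2 is determined by its type and its k-set, and distinct
-- elements of F are incident exactly when their types differ and their k-sets are disjoint. So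
-- F uses r − 2 types and k(r − 2) points of Ω, leaving 2 free types and n free points, and an
-- element lies in the residue of F iff its type is free and its k-set consists of free points.
-- Renumbering the free types as 0, 1 and the free points as 1, …, n turns the residue into the
-- neighbourhood geometry of KG(n, k): incidence in both is "equal, or of different types and
-- disjoint".

module Submission where

open import Defs
open import Data.Nat using (ℕ; suc; _≤_; _+_; _*_; _∸_; _≡ᵇ_)
open import Data.Nat.Properties using (+-suc; *-suc; *-zeroʳ; ≡ᵇ⇒≡; m+n∸n≡m; m∸[m∸n]≡n)
open import Data.Bool using (Bool; true; false; T; not; _∧_; _∨_)
open import Data.Bool.Properties using (∧-zeroʳ; ∧-assoc; T-∧; T-irrelevant)
open import Data.Empty using (⊥-elim)
open import Data.Fin using (Fin; zero; suc; _≟_; cast)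
open import Data.Fin.Properties using (suc-injective; cast-involutive)
open import Data.Fin.Subset using (Subset; ∣_∣; _∪_; ∁; ⁅_⁆; ⊥)
open import Data.Fin.Subset.Properties using (∣⁅x⁆∣≡1; ∣∁p∣≡n∸∣p∣; ∣⊥∣≡0)
open import Data.Vec using ([]; _∷_)
open import Data.List using (List; []; _∷_; length; foldr)
open import Data.List.Relation.Unary.All using (All; []; _∷_)
import Data.List.Relation.Unary.All as All
open import Data.Bool.ListAction using (all)
open import Data.List.Relation.Unary.AllPairs using (_∷_)
open import Data.Product using (Σ; _,_; proj₁; proj₂)
open import Function.Base using (_∘_)
open import Function.Definitions using (Bijective)
open import Function.Bundles using (_⇔_; mk⇔; Equivalence)
open import Function.Consequences.Propositional
  using (inverseᵇ⇒bijective; strictlyInverseˡ⇒inverseˡ; strictlyInverseʳ⇒inverseʳ)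
open import Relation.Nullary using (¬_; yes; no)
open import Relation.Nullary.Decidable using (Dec; ⌊_⌋; isYes≗does; does-⇔)
open import Relation.Binary.PropositionalEquality

isYes-⇔ : ∀ {a b} {A : Set a} {B : Set b} → A ⇔ B → (a? : Dec A) (b? : Dec B) → ⌊ a? ⌋ ≡ ⌊ b? ⌋
isYes-⇔ A⇔B a? b? = trans (isYes≗does a?) (trans (does-⇔ A⇔B a? b?) (sym (isYes≗does b?)))

≡-from-proj₁ : ∀ {a} {A : Set a} {P : A → Bool} {x y : Σ A (λ z → T (P z))} →
               proj₁ x ≡ proj₁ y → x ≡ y
≡-from-proj₁ {x = z , p} {.z , q} refl = cong (z ,_) (T-irrelevant p q)

∧-interchange : ∀ a b c d → (a ∧ b) ∧ (c ∧ d) ≡ (a ∧ c) ∧ (b ∧ d)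
∧-interchange true  true  c d = refl
∧-interchange true  false c d = sym (∧-zeroʳ c)
∧-interchange false b     c d = refl

disjoint-⊥ʳ : ∀ {m} (p : Subset m) → disjoint p ⊥ ≡ true
disjoint-⊥ʳ []          = refl
disjoint-⊥ʳ (true ∷ p)  = disjoint-⊥ʳ p
disjoint-⊥ʳ (false ∷ p) = disjoint-⊥ʳ p

disjoint-⊥ˡ : ∀ {m} (p : Subset m) → disjoint ⊥ p ≡ true
disjoint-⊥ˡ []      = refl
disjoint-⊥ˡ (_ ∷ p) = disjoint-⊥ˡ p

disjoint-∪ʳ : ∀ {m} (p q s : Subset m) → disjoint p (q ∪ s) ≡ disjoint p q ∧ disjoint p s
disjoint-∪ʳ []          []          []          = refl
disjoint-∪ʳ (false ∷ p) (_ ∷ q)     (_ ∷ s)     = disjoint-∪ʳ p q s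
disjoint-∪ʳ (true ∷ p)  (true ∷ q)  (_ ∷ s)     = refl
disjoint-∪ʳ (true ∷ p)  (false ∷ q) (true ∷ s)  = sym (∧-zeroʳ (disjoint p q))
disjoint-∪ʳ (true ∷ p)  (false ∷ q) (false ∷ s) = disjoint-∪ʳ p q s

disjoint-⁅⁆ : ∀ {m} (τ σ : Fin m) → disjoint ⁅ τ ⁆ ⁅ σ ⁆ ≡ not ⌊ τ ≟ σ ⌋
disjoint-⁅⁆ zero    zero    = refl
disjoint-⁅⁆ zero    (suc σ) = disjoint-⊥ˡ ⁅ σ ⁆
disjoint-⁅⁆ (suc τ) zero    = disjoint-⊥ʳ ⁅ τ ⁆
disjoint-⁅⁆ (suc τ) (suc σ) =
  trans (disjoint-⁅⁆ τ σ) (cong not (isYes-⇔ (mk⇔ (cong suc) suc-injective) (τ ≟ σ) (suc τ ≟ suc σ)))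

∣∪∣-disjoint : ∀ {m} (p q : Subset m) → T (disjoint p q) → ∣ p ∪ q ∣ ≡ ∣ p ∣ + ∣ q ∣
∣∪∣-disjoint []          []          _ = refl
∣∪∣-disjoint (true ∷ p)  (false ∷ q) h = cong suc (∣∪∣-disjoint p q h)
∣∪∣-disjoint (false ∷ p) (true ∷ q)  h = trans (cong suc (∣∪∣-disjoint p q h)) (sym (+-suc ∣ p ∣ ∣ q ∣))
∣∪∣-disjoint (false ∷ p) (false ∷ q) h = ∣∪∣-disjoint p q h

restrict∁ : ∀ {m} (U : Subset m) → Subset m → Subset ∣ ∁ U ∣
restrict∁ []          []      = []
restrict∁ (true ∷ U)  (_ ∷ s) = restrict∁ U s
restrict∁ (false ∷ U) (b ∷ s) = b ∷ restrict∁ U s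

extend∁ : ∀ {m} (U : Subset m) → Subset ∣ ∁ U ∣ → Subset m
extend∁ []          _       = []
extend∁ (true ∷ U)  s       = false ∷ extend∁ U s
extend∁ (false ∷ U) (b ∷ s) = b ∷ extend∁ U s

restrict∁-extend∁ : ∀ {m} (U : Subset m) s → restrict∁ U (extend∁ U s) ≡ s
restrict∁-extend∁ []          []      = refl
restrict∁-extend∁ (true ∷ U)  s       = restrict∁-extend∁ U s
restrict∁-extend∁ (false ∷ U) (b ∷ s) = cong (b ∷_) (restrict∁-extend∁ U s)

extend∁-restrict∁ : ∀ {m} (U : Subset m) s → T (disjoint s U) → extend∁ U (restrict∁ U s) ≡ s
extend∁-restrict∁ []          []          _ = refl
extend∁-restrict∁ (true ∷ U)  (false ∷ s) h = cong (false ∷_) (extend∁-restrict∁ U s h)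
extend∁-restrict∁ (false ∷ U) (true ∷ s)  h = cong (true ∷_) (extend∁-restrict∁ U s h)
extend∁-restrict∁ (false ∷ U) (false ∷ s) h = cong (false ∷_) (extend∁-restrict∁ U s h)

extend∁-disjoint : ∀ {m} (U : Subset m) s → T (disjoint (extend∁ U s) U)
extend∁-disjoint []          []          = _
extend∁-disjoint (true ∷ U)  s           = extend∁-disjoint U s
extend∁-disjoint (false ∷ U) (true ∷ s)  = extend∁-disjoint U s
extend∁-disjoint (false ∷ U) (false ∷ s) = extend∁-disjoint U s

∣extend∁∣ : ∀ {m} (U : Subset m) s → ∣ extend∁ U s ∣ ≡ ∣ s ∣
∣extend∁∣ []          []          = refl
∣extend∁∣ (true ∷ U)  s           = ∣extend∁∣ U s
∣extend∁∣ (false ∷ U) (true ∷ s)  = cong suc (∣extend∁∣ U s)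
∣extend∁∣ (false ∷ U) (false ∷ s) = ∣extend∁∣ U s

∣restrict∁∣ : ∀ {m} (U : Subset m) s → T (disjoint s U) → ∣ restrict∁ U s ∣ ≡ ∣ s ∣
∣restrict∁∣ U s h = trans (sym (∣extend∁∣ U (restrict∁ U s))) (cong ∣_∣ (extend∁-restrict∁ U s h))

disjoint-restrict∁ : ∀ {m} (U : Subset m) s t → T (disjoint s U) →
                     disjoint (restrict∁ U s) (restrict∁ U t) ≡ disjoint s t
disjoint-restrict∁ []          []          []          _ = refl
disjoint-restrict∁ (true ∷ U)  (false ∷ s) (_ ∷ t)     h = disjoint-restrict∁ U s t h
disjoint-restrict∁ (false ∷ U) (false ∷ s) (_ ∷ t)     h = disjoint-restrict∁ U s t h
disjoint-restrict∁ (false ∷ U) (true ∷ s)  (false ∷ t) h = disjoint-restrict∁ U s t h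
disjoint-restrict∁ (false ∷ U) (true ∷ s)  (true ∷ t)  h = refl

rank∁ : ∀ {m} (U : Subset m) (τ : Fin m) → .(T (disjoint ⁅ τ ⁆ U)) → Fin ∣ ∁ U ∣
rank∁ (false ∷ U) zero    _ = zero
rank∁ (true ∷ U)  zero    ()
rank∁ (true ∷ U)  (suc τ) h = rank∁ U τ h
rank∁ (false ∷ U) (suc τ) h = suc (rank∁ U τ h)

select∁ : ∀ {m} (U : Subset m) → Fin ∣ ∁ U ∣ → Fin m
select∁ (true ∷ U)  i       = suc (select∁ U i)
select∁ (false ∷ U) zero    = zero
select∁ (false ∷ U) (suc i) = suc (select∁ U i)

select∁-disjoint : ∀ {m} (U : Subset m) i → T (disjoint ⁅ select∁ U i ⁆ U)
select∁-disjoint (true ∷ U)  i       = select∁-disjoint U i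
select∁-disjoint (false ∷ U) zero    = subst T (sym (disjoint-⊥ˡ U)) _
select∁-disjoint (false ∷ U) (suc i) = select∁-disjoint U i

rank∁-select∁ : ∀ {m} (U : Subset m) i → rank∁ U (select∁ U i) (select∁-disjoint U i) ≡ i
rank∁-select∁ (true ∷ U)  i       = rank∁-select∁ U i
rank∁-select∁ (false ∷ U) zero    = refl
rank∁-select∁ (false ∷ U) (suc i) = cong suc (rank∁-select∁ U i)

rank∁-cong : ∀ {m} (U : Subset m) {τ σ} .{h : T (disjoint ⁅ τ ⁆ U)} .{h′ : T (disjoint ⁅ σ ⁆ U)} →
             τ ≡ σ → rank∁ U τ h ≡ rank∁ U σ h′
rank∁-cong U refl = refl

select∁-rank∁ : ∀ {m} (U : Subset m) τ .(h : T (disjoint ⁅ τ ⁆ U)) → select∁ U (rank∁ U τ h) ≡ τ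
select∁-rank∁ (false ∷ U) zero    _ = refl
select∁-rank∁ (true ∷ U)  zero    ()
select∁-rank∁ (true ∷ U)  (suc τ) h = cong suc (select∁-rank∁ U τ h)
select∁-rank∁ (false ∷ U) (suc τ) h = cong suc (select∁-rank∁ U τ h)

module ResiduesOfΓ (n k r : ℕ) where

  Ω : ℕ
  Ω = n + k * (r ∸ 2)

  G : IncSys
  G = Γ n k r

  E : Set
  E = Elt G

  type : E → Fin r
  type = proj₁

  points : E → Subset Ω
  points x = proj₁ (proj₂ x)

  apart : E → E → Bool
  apart x y = not ⌊ type x ≟ type y ⌋ ∧ disjoint (points x) (points y)

  types : List E → Subset r
  types = foldr (λ f → ⁅ type f ⁆ ∪_) ⊥

  support : List E → Subset Ω
  support = foldr (λ f → points f ∪_) ⊥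

  avoids : E → List E → Bool
  avoids x F = disjoint ⁅ type x ⁆ (types F) ∧ disjoint (points x) (support F)

  inc-≢ : ∀ x y → ¬ x ≡ y → inc G x y ≡ apart x y
  inc-≢ x y x≢y with _≟ₑ_ G x y
  ... | yes x≡y = ⊥-elim (x≢y x≡y)
  ... | no _    = refl

  apart-irreflexive : ∀ x → apart x x ≡ false
  apart-irreflexive x with type x ≟ type x
  ... | yes _ = refl
  ... | no τ≢τ = ⊥-elim (τ≢τ refl)

  avoids-[] : ∀ x → avoids x [] ≡ true
  avoids-[] x = cong₂ _∧_ (disjoint-⊥ʳ ⁅ type x ⁆) (disjoint-⊥ʳ (points x))

  avoids-∷ : ∀ x f F → avoids x (f ∷ F) ≡ apart x f ∧ avoids x F
  avoids-∷ x f F = begin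
    avoids x (f ∷ F)           ≡⟨ cong₂ _∧_ (disjoint-∪ʳ ⁅ type x ⁆ ⁅ type f ⁆ (types F))
                                            (disjoint-∪ʳ (points x) (points f) (support F)) ⟩
    (τf ∧ τF) ∧ (sf ∧ sF)      ≡⟨ ∧-interchange τf τF sf sF ⟩
    (τf ∧ sf) ∧ avoids x F     ≡⟨ cong (λ b → (b ∧ sf) ∧ avoids x F) (disjoint-⁅⁆ (type x) (type f)) ⟩
    apart x f ∧ avoids x F     ∎
    where
    open ≡-Reasoning
    τf τF sf sF : Bool
    τf = disjoint ⁅ type x ⁆ ⁅ type f ⁆
    τF = disjoint ⁅ type x ⁆ (types F)
    sf = disjoint (points x) (points f)
    sF = disjoint (points x) (support F)

  residue-condition : ∀ x F → all (inc G x) F ∧ not (memb G x F) ≡ avoids x F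
  residue-condition x []      = sym (avoids-[] x)
  -- The `with` also decides the equality test inside `inc G x f`.
  residue-condition x (f ∷ F) with _≟ₑ_ G x f
  ... | yes refl = trans (∧-zeroʳ _) (sym (begin
    avoids x (x ∷ F)        ≡⟨ avoids-∷ x x F ⟩
    apart x x ∧ avoids x F  ≡⟨ cong (_∧ avoids x F) (apart-irreflexive x) ⟩
    false                   ∎))
    where open ≡-Reasoning
  ... | no _ = trans (∧-assoc (apart x f) _ _) (begin
    apart x f ∧ (all (inc G x) F ∧ not (memb G x F))  ≡⟨ cong (apart x f ∧_) (residue-condition x F) ⟩
    apart x f ∧ avoids x F                            ≡⟨ avoids-∷ x f F ⟨
    avoids x (f ∷ F)                                  ∎)
    where open ≡-Reasoning

  avoids-types : ∀ x F → T (avoids x F) → T (disjoint ⁅ type x ⁆ (types F))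
  avoids-types _ _ = proj₁ ∘ Equivalence.to T-∧

  avoids-points : ∀ x F → T (avoids x F) → T (disjoint (points x) (support F))
  avoids-points _ _ = proj₂ ∘ Equivalence.to T-∧

  avoids-of-apart : ∀ x F → All (λ f → T (apart x f)) F → T (avoids x F)
  avoids-of-apart x []      []       = subst T (sym (avoids-[] x)) _
  avoids-of-apart x (f ∷ F) (a ∷ as) =
    subst T (sym (avoids-∷ x f F)) (Equivalence.from T-∧ (a , avoids-of-apart x F as))

  flag-tail : ∀ {f F} → IsFlag G (f ∷ F) → IsFlag G F
  flag-tail record { unique = _ ∷ unique ; pairwise = _ ∷ pairwise } =
    record { unique = unique ; pairwise = pairwise }

  flag-head-avoids : ∀ {f F} → IsFlag G (f ∷ F) → T (avoids f F)
  flag-head-avoids {f} {F} record { unique = distinct ∷ _ ; pairwise = incident ∷ _ } =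
    avoids-of-apart f F (All.zipWith (λ (f≢g , fg) → subst T (inc-≢ f _ f≢g) fg) (distinct , incident))

  ∣types∣ : ∀ F → IsFlag G F → ∣ types F ∣ ≡ length F
  ∣types∣ []      _    = ∣⊥∣≡0 r
  ∣types∣ (f ∷ F) flag = begin
    ∣ ⁅ type f ⁆ ∪ types F ∣      ≡⟨ ∣∪∣-disjoint ⁅ type f ⁆ (types F) (avoids-types f F f-avoids) ⟩
    ∣ ⁅ type f ⁆ ∣ + ∣ types F ∣  ≡⟨ cong₂ _+_ (∣⁅x⁆∣≡1 (type f)) (∣types∣ F (flag-tail flag)) ⟩
    suc (length F)                ∎
    where
    open ≡-Reasoning
    f-avoids : T (avoids f F)
    f-avoids = flag-head-avoids flag

  ∣support∣ : ∀ F → IsFlag G F → ∣ support F ∣ ≡ k * length F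
  ∣support∣ []      _    = trans (∣⊥∣≡0 Ω) (sym (*-zeroʳ k))
  ∣support∣ (f ∷ F) flag = begin
    ∣ points f ∪ support F ∣      ≡⟨ ∣∪∣-disjoint (points f) (support F) (avoids-points f F f-avoids) ⟩
    ∣ points f ∣ + ∣ support F ∣  ≡⟨ cong₂ _+_ (≡ᵇ⇒≡ _ k (proj₂ (proj₂ f))) (∣support∣ F (flag-tail flag)) ⟩
    k + k * length F              ≡⟨ *-suc k (length F) ⟨
    k * suc (length F)            ∎
    where
    open ≡-Reasoning
    f-avoids : T (avoids f F)
    f-avoids = flag-head-avoids flag

  ∣∁types∣≡2 : ∀ F → IsFlag G F → length F ≡ r ∸ 2 → 2 ≤ r → ∣ ∁ (types F) ∣ ≡ 2
  ∣∁types∣≡2 F flag len 2≤r = begin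
    ∣ ∁ (types F) ∣  ≡⟨ ∣∁p∣≡n∸∣p∣ (types F) ⟩
    r ∸ ∣ types F ∣  ≡⟨ cong (r ∸_) (trans (∣types∣ F flag) len) ⟩
    r ∸ (r ∸ 2)      ≡⟨ m∸[m∸n]≡n 2≤r ⟩
    2                ∎
    where open ≡-Reasoning

  ∣∁support∣≡n : ∀ F → IsFlag G F → length F ≡ r ∸ 2 → ∣ ∁ (support F) ∣ ≡ n
  ∣∁support∣≡n F flag len = begin
    ∣ ∁ (support F) ∣              ≡⟨ ∣∁p∣≡n∸∣p∣ (support F) ⟩
    Ω ∸ ∣ support F ∣              ≡⟨ cong (Ω ∸_) (trans (∣support∣ F flag) (cong (k *_) len)) ⟩
    n + k * (r ∸ 2) ∸ k * (r ∸ 2)  ≡⟨ m+n∸n≡m n (k * (r ∸ 2)) ⟩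
    n                              ∎
    where open ≡-Reasoning

  module ResidueIsomorphism (F : List E) (two : ∣ ∁ (types F) ∣ ≡ 2) where

    𝒯 : Subset r
    𝒯 = types F

    𝒮 : Subset Ω
    𝒮 = support F

    R : IncSys
    R = Residue G F

    K : IncSys
    K = Nbhd (KG ∣ ∁ 𝒮 ∣ k)

    residue-avoids : (x : Elt R) → T (avoids (proj₁ x) F)
    residue-avoids (x , h) = subst T (residue-condition x F) h

    type-free : (x : Elt R) → T (disjoint ⁅ type (proj₁ x) ⁆ 𝒯)
    type-free x = avoids-types (proj₁ x) F (residue-avoids x)

    points-free : (x : Elt R) → T (disjoint (points (proj₁ x)) 𝒮)
    points-free x = avoids-points (proj₁ x) F (residue-avoids x)

    type-index : Elt R → Fin 2
    type-index x = cast two (rank∁ 𝒯 (type (proj₁ x)) (type-free x))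

    φ : Elt R → Elt K
    φ x = (restrict∁ 𝒮 s , ∣restrict∁∣≡k) , type-index x
      where
      s : Subset Ω
      s = points (proj₁ x)
      ∣restrict∁∣≡k : T (∣ restrict∁ 𝒮 s ∣ ≡ᵇ k)
      ∣restrict∁∣≡k = subst (λ c → T (c ≡ᵇ k)) (sym (∣restrict∁∣ 𝒮 s (points-free x)))
                             (proj₂ (proj₂ (proj₁ x)))

    ψ : Elt K → Elt R
    ψ ((s , ∣s∣≡k) , i) = x , subst T (sym (residue-condition x F)) x-avoids
      where
      x : E
      x = select∁ 𝒯 (cast (sym two) i) , extend∁ 𝒮 s , subst (λ c → T (c ≡ᵇ k)) (sym (∣extend∁∣ 𝒮 s)) ∣s∣≡k
      x-avoids : T (avoids x F)
      x-avoids = Equivalence.from T-∧ (select∁-disjoint 𝒯 _ , extend∁-disjoint 𝒮 s)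

    φ-ψ : ∀ y → φ (ψ y) ≡ y
    φ-ψ ((s , _) , i) = cong₂ _,_ (≡-from-proj₁ (restrict∁-extend∁ 𝒮 s)) (begin
      cast two (rank∁ 𝒯 (select∁ 𝒯 (cast (sym two) i)) _)  ≡⟨ cong (cast two) (rank∁-select∁ 𝒯 _) ⟩
      cast two (cast (sym two) i)                         ≡⟨ cast-involutive two (sym two) i ⟩
      i                                                   ∎)
      where open ≡-Reasoning

    select∁-type-index : ∀ x → select∁ 𝒯 (cast (sym two) (type-index x)) ≡ type (proj₁ x)
    select∁-type-index x = begin
      select∁ 𝒯 (cast (sym two) (type-index x))  ≡⟨ cong (select∁ 𝒯) (cast-involutive (sym two) two _) ⟩
      select∁ 𝒯 (rank∁ 𝒯 (type (proj₁ x)) _)    ≡⟨ select∁-rank∁ 𝒯 _ (type-free x) ⟩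
      type (proj₁ x)                            ∎
      where open ≡-Reasoning

    ψ-φ : ∀ x → ψ (φ x) ≡ x
    ψ-φ x = ≡-from-proj₁ (cong₂ _,_ (select∁-type-index x) (≡-from-proj₁ points-≡))
      where
      points-≡ : extend∁ 𝒮 (restrict∁ 𝒮 (points (proj₁ x))) ≡ points (proj₁ x)
      points-≡ = extend∁-restrict∁ 𝒮 (points (proj₁ x)) (points-free x)

    φ-bijective : Bijective _≡_ _≡_ φ
    φ-bijective = inverseᵇ⇒bijective (strictlyInverseˡ⇒inverseˡ φ φ-ψ , strictlyInverseʳ⇒inverseʳ φ ψ-φ)

    φ-≡-⇔ : ∀ x y → proj₁ x ≡ proj₁ y ⇔ φ x ≡ φ y
    φ-≡-⇔ x y = mk⇔ (cong φ ∘ ≡-from-proj₁) (cong proj₁ ∘ proj₁ φ-bijective)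

    type-index-⇔ : ∀ x y → type (proj₁ x) ≡ type (proj₁ y) ⇔ type-index x ≡ type-index y
    type-index-⇔ x y = mk⇔
      (λ τ≡σ → cong (cast two) (rank∁-cong 𝒯 τ≡σ))
      (λ i≡j → begin
        type (proj₁ x)                             ≡⟨ select∁-type-index x ⟨
        select∁ 𝒯 (cast (sym two) (type-index x))  ≡⟨ cong (select∁ 𝒯 ∘ cast (sym two)) i≡j ⟩
        select∁ 𝒯 (cast (sym two) (type-index y))  ≡⟨ select∁-type-index y ⟩
        type (proj₁ y)                             ∎)
      where open ≡-Reasoning

    inc-φ : ∀ x y → inc R x y ≡ inc K (φ x) (φ y)
    inc-φ x@(x₁ , _) y@(y₁ , _) = cong₂ _∨_
      (isYes-⇔ (φ-≡-⇔ x y) (_≟ₑ_ G x₁ y₁) (_≟ₑ_ K (φ x) (φ y)))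
      (cong₂ _∧_
        (cong not (isYes-⇔ (type-index-⇔ x y) (type x₁ ≟ type y₁) (type-index x ≟ type-index y)))
        (sym (disjoint-restrict∁ 𝒮 (points x₁) (points y₁) (points-free x))))

    residue≅ : Isomorphic R K
    residue≅ = φ , φ-bijective , inc-φ , λ x y → Equivalence.to (type-index-⇔ x y)

lemma4p7 : (n k r : ℕ) → 1 ≤ k → 2 * k + 1 ≤ n → 2 ≤ r →
    (F : List (Elt (Γ n k r))) → IsFlag (Γ n k r) F → length F ≡ r ∸ 2 →
    Isomorphic (Residue (Γ n k r) F) (Nbhd (KG n k))
lemma4p7 n k r _ _ 2≤r F flag len =
  subst (λ m → Isomorphic (Residue (Γ n k r) F) (Nbhd (KG m k)))
        (∣∁support∣≡n F flag len)
        (ResidueIsomorphism.residue≅ F (∣∁types∣≡2 F flag len 2≤r))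
  where open ResiduesOfΓ n k r
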